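{- Let $M$ be a connected matroid with $\lambda(M)=\sigma(M)=k$, and let $C_1,\ldots,C_\ell$ be the minimum cocircuits of $M$. Then for all $i\neq j$, $C_i$ is a minimum cocircuit of $M\setminus C_j$.
   Context: $\sigma(M)$ is the largest number of pairwise disjoint bases of $M$. A cocircuit is a minimal subset of the ground set meeting every base; $\lambda(M)$ (cogirth) is the smallest size of a cocircuit; a minimum cocircuit of a matroid is a cocircuit of smallest size in that matroid. $M\setminus C$ denotes the deletion of $C$. -}

module Defs where

open import Data.Nat using (ℕ; suc; _<_; _≤_)
open import Data.Fin using (Fin)
open import Data.Fin.Subset using (Subset; _∈_; _∉_; _⊆_; _∩_; _∪_; _─_; ⁅_⁆; ∣_∣; Nonempty; Empty; ⊥)
open import Data.Product using (_×_; ∃; ∃-syntax)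
open import Relation.Nullary using (¬_)
open import Relation.Binary.PropositionalEquality using (_≡_; _≢_)

record SetSystem (n : ℕ) : Set₁ where
  field
    ground : Subset n
    Indep  : Subset n → Set
open SetSystem public

record IsMatroid {n : ℕ} (M : SetSystem n) : Set where
  field
    indep⊆ground : ∀ I → Indep M I → I ⊆ ground M
    indep-empty  : Indep M ⊥
    indep-down   : ∀ I J → Indep M J → I ⊆ J → Indep M I
    indep-aug    : ∀ I J → Indep M I → Indep M J → ∣ I ∣ < ∣ J ∣ →
                   ∃[ e ] (e ∈ J × e ∉ I × Indep M (I ∪ ⁅ e ⁆))

module _ {n : ℕ} (M : SetSystem n) where

  Base : Subset n → Set
  Base B = Indep M B × (∀ X → Indep M X → B ⊆ X → X ⊆ B)

  Circuit : Subset n → Set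
  Circuit C = C ⊆ ground M × ¬ Indep M C ×
              (∀ D → D ⊆ C → ¬ Indep M D → C ⊆ D)

  MeetsEveryBase : Subset n → Set
  MeetsEveryBase X = ∀ B → Base B → Nonempty (X ∩ B)

  Cocircuit : Subset n → Set
  Cocircuit C = C ⊆ ground M × MeetsEveryBase C ×
                (∀ D → D ⊆ C → MeetsEveryBase D → C ⊆ D)

  Connected : Set
  Connected = ∀ x y → x ∈ ground M → y ∈ ground M → x ≢ y →
              ∃[ C ] (Circuit C × x ∈ C × y ∈ C)

  -- λ(M) = k : k is the smallest size of a cocircuit
  CogirthIs : ℕ → Set
  CogirthIs k = (∃[ C ] (Cocircuit C × ∣ C ∣ ≡ k)) ×
                (∀ C → Cocircuit C → k ≤ ∣ C ∣)

  HasDisjointBases : ℕ → Set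
  HasDisjointBases m = ∃ λ (Bs : Fin m → Subset n) → ((∀ (i : Fin m) → Base (Bs i)) ×
                        (∀ i j → i ≢ j → Empty (Bs i ∩ Bs j)))

  SigmaIs : ℕ → Set
  SigmaIs k = HasDisjointBases k × ¬ HasDisjointBases (suc k)

  MinCocircuit : Subset n → Set
  MinCocircuit C = Cocircuit C × (∀ D → Cocircuit D → ∣ C ∣ ≤ ∣ D ∣)

_∖_ : ∀ {n} → SetSystem n → Subset n → SetSystem n
M ∖ C = record { ground = ground M ─ C ; Indep = λ I → Indep M I × Empty (I ∩ C) }

-- Let B₁, …, B_k be disjoint bases of M. Every cocircuit meets every base, so a cocircuit
-- of size k meets each Bₜ in exactly one element, and Bₜ minus that element avoids it.
-- If two minimum cocircuits shared an element x ∈ Bₜ, then I = Bₜ − x would avoid both;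
-- since the complement of a cocircuit is a hyperplane, I ∪ {f} is independent, hence a
-- base, for any f ∈ Cⱼ − Cᵢ, and this base misses Cᵢ. So minimum cocircuits are disjoint.
-- Removing from each Bₜ its element of Cⱼ gives k disjoint bases of M ∖ Cⱼ (of rank
-- r(M) − 1), so every set meeting all bases of M ∖ Cⱼ has at least k elements; and Cᵢ
-- meets all of them, because a base of M ∖ Cⱼ missing Cᵢ extends to a base of M by an
-- element that would lie in both Cᵢ and Cⱼ.
module Submission where

open import Defs
open import Data.Nat using (ℕ; zero; suc; _<_; _≤_; z≤n; s≤s)
open import Data.Nat.Properties using (≤-antisym; ≤-trans; ≤-reflexive; ≮⇒≥; <⇒≱)
open import Data.Fin using (Fin; _≟_; fromℕ<) renaming (zero to fzero; suc to fsuc)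
open import Data.Fin.Properties using (any?; suc-injective)
open import Data.Fin.Subset
  using (Subset; _∈_; _∉_; _⊆_; _∩_; _∪_; _─_; _-_; ⁅_⁆; ∣_∣; Nonempty; Empty; inside; outside)
  renaming (⊥ to ∅)
open import Data.Fin.Subset.Properties
  using ( _∈?_; x∈p∩q⁻; x∈p∩q⁺; x∈p∪q⁻; x∈p∪q⁺; x∈⁅x⁆; x∈⁅y⁆⇒x≡y; ∉⊥; p─⊥≡p
        ; ∪-identityʳ; p⊆p∪q; p─q⊆p; p⊂q⇒∣p∣<∣q∣; x∈p⇒∣p-x∣<∣p∣; Empty-unique; ⊆-antisym
        ; x∈p∧x∉q⇒x∈p─q; x∈p∧x≢y⇒x∈p-y; nonempty?)
open import Data.Vec using (_∷_)
open import Data.Vec.Base using (here; there)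
open import Data.Product using (_×_; _,_; proj₁; proj₂; ∃-syntax)
open import Data.Sum using (_⊎_; inj₁; inj₂)
open import Data.Empty using (⊥-elim)
open import Relation.Nullary using (¬_; yes; no)
open import Relation.Nullary.Decidable using (_×-dec_; ¬?; decidable-stable)
open import Relation.Binary.PropositionalEquality using (_≡_; _≢_; refl; sym; trans; cong; subst)
open import Function using (_∘_; id)

variable
  n k : ℕ
  x y : Fin n
  p q : Subset n

x∈p⇒suc∣p-x∣≡∣p∣ : x ∈ p → suc ∣ p - x ∣ ≡ ∣ p ∣
x∈p⇒suc∣p-x∣≡∣p∣ {x = fzero}  {inside ∷ p}  here      = cong (suc ∘ ∣_∣) (p─⊥≡p p)
x∈p⇒suc∣p-x∣≡∣p∣ {x = fsuc _} {inside ∷ _}  (there m) = cong suc (x∈p⇒suc∣p-x∣≡∣p∣ m)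
x∈p⇒suc∣p-x∣≡∣p∣ {x = fsuc _} {outside ∷ _} (there m) = x∈p⇒suc∣p-x∣≡∣p∣ m

x∉p⇒∣p∪⁅x⁆∣≡suc∣p∣ : x ∉ p → ∣ p ∪ ⁅ x ⁆ ∣ ≡ suc ∣ p ∣
x∉p⇒∣p∪⁅x⁆∣≡suc∣p∣ {x = fzero}  {inside ∷ _}  x∉p = ⊥-elim (x∉p here)
x∉p⇒∣p∪⁅x⁆∣≡suc∣p∣ {x = fzero}  {outside ∷ p} x∉p = cong (suc ∘ ∣_∣) (∪-identityʳ p)
x∉p⇒∣p∪⁅x⁆∣≡suc∣p∣ {x = fsuc _} {inside ∷ _}  x∉p = cong suc (x∉p⇒∣p∪⁅x⁆∣≡suc∣p∣ (x∉p ∘ there))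
x∉p⇒∣p∪⁅x⁆∣≡suc∣p∣ {x = fsuc _} {outside ∷ _} x∉p = x∉p⇒∣p∪⁅x⁆∣≡suc∣p∣ (x∉p ∘ there)

x∈p─q⇒x∉q : x ∈ p ─ q → x ∉ q
x∈p─q⇒x∉q {x = fzero}  {inside ∷ _} {outside ∷ _} here      ()
x∈p─q⇒x∉q {x = fsuc _} {_ ∷ _}      {_ ∷ _}       (there m) (there m') = x∈p─q⇒x∉q m m'

x∈p∪⁅x⁆ : ∀ (p : Subset n) x → x ∈ p ∪ ⁅ x ⁆
x∈p∪⁅x⁆ p x = x∈p∪q⁺ (inj₂ (x∈⁅x⁆ x))

x∈p∪⁅y⁆⇒x∈p⊎x≡y : x ∈ p ∪ ⁅ y ⁆ → x ∈ p ⊎ x ≡ y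
x∈p∪⁅y⁆⇒x∈p⊎x≡y {p = p} {y} m with x∈p∪q⁻ p ⁅ y ⁆ m
... | inj₁ x∈p = inj₁ x∈p
... | inj₂ x∈⁅y⁆ = inj₂ (x∈⁅y⁆⇒x≡y y x∈⁅y⁆)

Nonempty-∩-comm : Nonempty (p ∩ q) → Nonempty (q ∩ p)
Nonempty-∩-comm {p = p} {q} (x , m) with x∈p∩q⁻ p q m
... | x∈p , x∈q = x , x∈p∩q⁺ (x∈q , x∈p)

Empty-∩-mono : {p′ q′ : Subset n} → p ⊆ p′ → q ⊆ q′ → Empty (p′ ∩ q′) → Empty (p ∩ q)
Empty-∩-mono {p = p} {q} p⊆p′ q⊆q′ p′∩q′=∅ (x , m) with x∈p∩q⁻ p q m
... | x∈p , x∈q = p′∩q′=∅ (x , x∈p∩q⁺ (p⊆p′ x∈p , q⊆q′ x∈q))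

p⊆q∧∣q∣≤∣p∣⇒q⊆p : p ⊆ q → ∣ q ∣ ≤ ∣ p ∣ → q ⊆ p
p⊆q∧∣q∣≤∣p∣⇒q⊆p {p = p} p⊆q ∣q∣≤∣p∣ {x} x∈q =
  decidable-stable (x ∈? p) λ x∉p → <⇒≱ (p⊂q⇒∣p∣<∣q∣ (p⊆q , x , x∈q , x∉p)) ∣q∣≤∣p∣

∣p∣≡0⇒p≡∅ : ∣ p ∣ ≡ 0 → p ≡ ∅
∣p∣≡0⇒p≡∅ {p = p} ∣p∣≡0 = Empty-unique λ (x , x∈p) →
  <⇒≱ (subst (∣ p - x ∣ <_) ∣p∣≡0 (x∈p⇒∣p-x∣<∣p∣ x∈p)) z≤n

distinct∧∣p∣≡∣q∣≡k⇒0<k : p ≢ q → ∣ p ∣ ≡ k → ∣ q ∣ ≡ k → 0 < k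
distinct∧∣p∣≡∣q∣≡k⇒0<k {k = zero}  p≢q ∣p∣≡0 ∣q∣≡0 =
  ⊥-elim (p≢q (trans (∣p∣≡0⇒p≡∅ ∣p∣≡0) (sym (∣p∣≡0⇒p≡∅ ∣q∣≡0))))
distinct∧∣p∣≡∣q∣≡k⇒0<k {k = suc _} _ _ _ = s≤s z≤n

PairwiseDisjoint : (Fin k → Subset n) → Set
PairwiseDisjoint A = ∀ i j → i ≢ j → Empty (A i ∩ A j)

Hits : (Fin k → Subset n) → Subset n → Set
Hits A D = ∀ i → Nonempty (A i ∩ D)

hitting-set-size : {A : Fin k → Subset n} {D : Subset n} →
                   PairwiseDisjoint A → Hits A D → k ≤ ∣ D ∣
hitting-set-size {k = zero}  _ _ = z≤n
hitting-set-size {k = suc k} {A = A} {D} disjoint hits with hits fzero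
... | x , x∈A₀∩D with x∈p∩q⁻ (A fzero) D x∈A₀∩D
... | x∈A₀ , x∈D = ≤-trans (s≤s (hitting-set-size disjoint′ hits′)) (≤-reflexive (x∈p⇒suc∣p-x∣≡∣p∣ x∈D))
  where
  disjoint′ : PairwiseDisjoint (A ∘ fsuc)
  disjoint′ i j i≢j = disjoint (fsuc i) (fsuc j) (i≢j ∘ suc-injective)
  hits′ : Hits (A ∘ fsuc) (D - x)
  hits′ i with hits (fsuc i)
  ... | y , y∈Aᵢ∩D with x∈p∩q⁻ (A (fsuc i)) D y∈Aᵢ∩D
  ... | y∈Aᵢ , y∈D = y , x∈p∩q⁺ (y∈Aᵢ , x∈p∧x≢y⇒x∈p-y y∈D λ { refl →
        disjoint fzero (fsuc i) (λ ()) (x , x∈p∩q⁺ (x∈A₀ , y∈Aᵢ)) })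

-- Both facts hold because removing any element of a size-k hitting set destroys the
-- hitting property.
module TightHittingSet {A : Fin k → Subset n} {D : Subset n}
  (disjoint : PairwiseDisjoint A) (hits : Hits A D) (size : ∣ D ∣ ≡ k) where

  private
    ¬Hits-minus : x ∈ D → ¬ Hits A (D - x)
    ¬Hits-minus x∈D hits′ =
      <⇒≱ (subst (suc ∣ D - _ ∣ ≤_) size (≤-reflexive (x∈p⇒suc∣p-x∣≡∣p∣ x∈D))) (hitting-set-size disjoint hits′)

    hits-minus : ∀ {t} → x ∉ A t → Nonempty (A t ∩ (D - x))
    hits-minus {t = t} x∉Aₜ with hits t
    ... | y , y∈Aₜ∩D with x∈p∩q⁻ (A t) D y∈Aₜ∩D
    ... | y∈Aₜ , y∈D = y , x∈p∩q⁺ (y∈Aₜ , x∈p∧x≢y⇒x∈p-y y∈D λ { refl → x∉Aₜ y∈Aₜ })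

  ⊆-⋃ : x ∈ D → ∃[ t ] x ∈ A t
  ⊆-⋃ {x = x} x∈D = decidable-stable (any? λ t → x ∈? A t) λ x∉⋃ →
    ¬Hits-minus x∈D λ s → hits-minus (λ x∈Aₛ → x∉⋃ (s , x∈Aₛ))

  minus-avoids : ∀ {t} → x ∈ D → x ∈ A t → Empty ((A t - x) ∩ D)
  minus-avoids {x = x} {t} x∈D x∈Aₜ (y , m) with x∈p∩q⁻ (A t - x) D m
  ... | y∈Aₜ-x , y∈D = ¬Hits-minus x∈D hits′
    where
    hits′ : Hits A (D - x)
    hits′ s with s ≟ t
    ... | yes refl = y , x∈p∩q⁺ (p─q⊆p (A t) ⁅ x ⁆ y∈Aₜ-x , x∈p∧x∉q⇒x∈p─q y∈D (x∈p─q⇒x∉q y∈Aₜ-x))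
    ... | no s≢t = hits-minus λ x∈Aₛ → disjoint s t s≢t (x , x∈p∩q⁺ (x∈Aₛ , x∈Aₜ))

module _ {M : SetSystem n} where

  cocircuit-⊈ : ∀ {C D} → Cocircuit M C → Cocircuit M D → C ≢ D → ∃[ f ] (f ∈ D × f ∉ C)
  cocircuit-⊈ {C} {D} (_ , _ , minimalC) (_ , meetsD , _) C≢D =
    decidable-stable (any? λ f → f ∈? D ×-dec ¬? (f ∈? C)) λ D⊆C →
      C≢D (⊆-antisym (minimalC D (D⊆C′ D⊆C) meetsD) (D⊆C′ D⊆C))
    where
    D⊆C′ : ¬ (∃[ f ] (f ∈ D × f ∉ C)) → D ⊆ C
    D⊆C′ ¬w {f} f∈D = decidable-stable (f ∈? C) λ f∉C → ¬w (f , f∈D , f∉C)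

  minCocircuit-from-bound : ∀ {C} → C ⊆ ground M → MeetsEveryBase M C →
                            (∀ D → MeetsEveryBase M D → ∣ C ∣ ≤ ∣ D ∣) → MinCocircuit M C
  minCocircuit-from-bound C⊆E meetsC bound =
    (C⊆E , meetsC , λ D D⊆C meetsD → p⊆q∧∣q∣≤∣p∣⇒q⊆p D⊆C (bound D meetsD)) ,
    λ D (_ , meetsD , _) → bound D meetsD

  disjointBases⇒size≤meetsEveryBase : ∀ {D} → HasDisjointBases M k → MeetsEveryBase M D → k ≤ ∣ D ∣
  disjointBases⇒size≤meetsEveryBase (Bs , bases , disjoint) meetsD =
    hitting-set-size disjoint λ t → Nonempty-∩-comm (meetsD (Bs t) (bases t))

  cogirth⇒minCocircuit-size : ∀ {C} → CogirthIs M k → MinCocircuit M C → ∣ C ∣ ≡ k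
  cogirth⇒minCocircuit-size ((W , cocW , ∣W∣≡k) , k≤) (cocC , minimum) =
    ≤-antisym (≤-trans (minimum W cocW) (≤-reflexive ∣W∣≡k)) (k≤ _ cocC)

∖-isMatroid : {M : SetSystem n} {C : Subset n} → IsMatroid M → IsMatroid (M ∖ C)
∖-isMatroid {M = M} {C} isMatroid = record
  { indep⊆ground = λ I (indI , I∩C=∅) x∈I →
      x∈p∧x∉q⇒x∈p─q (indep⊆ground I indI x∈I) λ x∈C → I∩C=∅ (_ , x∈p∩q⁺ (x∈I , x∈C))
  ; indep-empty  = indep-empty , λ (_ , x∈∅∩C) → ∉⊥ (proj₁ (x∈p∩q⁻ ∅ C x∈∅∩C))
  ; indep-down   = λ I J (indJ , J∩C=∅) I⊆J → indep-down I J indJ I⊆J , Empty-∩-mono I⊆J id J∩C=∅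
  ; indep-aug    = aug
  }
  where
  open IsMatroid isMatroid
  aug : ∀ I J → Indep (M ∖ C) I → Indep (M ∖ C) J → ∣ I ∣ < ∣ J ∣ →
        ∃[ e ] (e ∈ J × e ∉ I × Indep (M ∖ C) (I ∪ ⁅ e ⁆))
  aug I J (indI , I∩C=∅) (indJ , J∩C=∅) ∣I∣<∣J∣ with indep-aug I J indI indJ ∣I∣<∣J∣
  ... | e , e∈J , e∉I , indIe = e , e∈J , e∉I , indIe , avoids
    where
    avoids : Empty ((I ∪ ⁅ e ⁆) ∩ C)
    avoids (y , m) with x∈p∩q⁻ (I ∪ ⁅ e ⁆) C m
    ... | y∈Ie , y∈C with x∈p∪⁅y⁆⇒x∈p⊎x≡y y∈Ie
    ... | inj₁ y∈I = I∩C=∅ (y , x∈p∩q⁺ (y∈I , y∈C))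
    ... | inj₂ refl = J∩C=∅ (y , x∈p∩q⁺ (e∈J , y∈C))

module Bases {M : SetSystem n} (isMatroid : IsMatroid M) where
  open IsMatroid isMatroid

  indep-size≤base-size : ∀ {B I} → Base M B → Indep M I → ∣ I ∣ ≤ ∣ B ∣
  indep-size≤base-size {B} {I} (indB , maximal) indI = ≮⇒≥ λ ∣B∣<∣I∣ →
    let (g , _ , g∉B , indBg) = indep-aug B I indB indI ∣B∣<∣I∣
    in g∉B (maximal (B ∪ ⁅ g ⁆) indBg (p⊆p∪q ⁅ g ⁆) (x∈p∪⁅x⁆ B g))

  base-size-unique : ∀ {B B′} → Base M B → Base M B′ → ∣ B ∣ ≡ ∣ B′ ∣
  base-size-unique b b′ = ≤-antisym (indep-size≤base-size b′ (proj₁ b)) (indep-size≤base-size b (proj₁ b′))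

  indep-large⇒base : ∀ {B I} → Base M B → Indep M I → ∣ B ∣ ≤ ∣ I ∣ → Base M I
  indep-large⇒base b indI ∣B∣≤∣I∣ =
    indI , λ Y indY I⊆Y → p⊆q∧∣q∣≤∣p∣⇒q⊆p I⊆Y (≤-trans (indep-size≤base-size b indY) ∣B∣≤∣I∣)

module MatroidProperties {M : SetSystem n} (isMatroid : IsMatroid M) where
  open IsMatroid isMatroid
  open Bases isMatroid

  -- I has rank r(M) − 1, so I ∪ {g} is a base, and it can only meet C in g.
  corank-one-extension-∈ : ∀ {B C I g} → Base M B → MeetsEveryBase M C → Empty (I ∩ C) →
                           suc ∣ I ∣ ≡ ∣ B ∣ → g ∉ I → Indep M (I ∪ ⁅ g ⁆) → g ∈ C
  corank-one-extension-∈ {B} {C} {I} {g} b meetsC I∩C=∅ size g∉I indIg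
    with meetsC _ (indep-large⇒base b indIg (≤-reflexive (trans (sym size) (sym (x∉p⇒∣p∪⁅x⁆∣≡suc∣p∣ g∉I)))))
  ... | h , m with x∈p∩q⁻ C (I ∪ ⁅ g ⁆) m
  ... | h∈C , h∈Ig with x∈p∪⁅y⁆⇒x∈p⊎x≡y h∈Ig
  ... | inj₁ h∈I = ⊥-elim (I∩C=∅ (h , x∈p∩q⁺ (h∈I , h∈C)))
  ... | inj₂ refl = h∈C

  -- The complement of a cocircuit is a hyperplane: if I ∪ {f} were dependent, every base
  -- would meet C − f, contradicting the minimality of C.
  cocircuit-extends : ∀ {B C I f} → Base M B → Cocircuit M C → Indep M I → Empty (I ∩ C) →
                      suc ∣ I ∣ ≡ ∣ B ∣ → f ∈ C → ¬ ¬ Indep M (I ∪ ⁅ f ⁆)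
  cocircuit-extends {B} {C} {I} {f} b (_ , meetsC , minimal) indI I∩C=∅ size f∈C ¬indIf =
    x∈p─q⇒x∉q (minimal (C - f) (p─q⊆p C ⁅ f ⁆) meetsC-f f∈C) (x∈⁅x⁆ f)
    where
    meetsC-f : MeetsEveryBase M (C - f)
    meetsC-f B′ b′ with nonempty? ((C - f) ∩ B′)
                      | indep-aug I B′ indI (proj₁ b′) (≤-reflexive (trans size (base-size-unique b b′)))
    ... | yes ne | _ = ne
    ... | no ¬ne | g , g∈B′ , g∉I , indIg with g ≟ f
    ...   | yes refl = ⊥-elim (¬indIf indIg)
    ...   | no g≢f = ⊥-elim (¬ne (g , x∈p∩q⁺ (x∈p∧x≢y⇒x∈p-y g∈C g≢f , g∈B′)))
      where
      g∈C : g ∈ C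
      g∈C = corank-one-extension-∈ b meetsC I∩C=∅ size g∉I indIg

  corank-one-avoiding⇒deletion-base : ∀ {B C I} → Base M B → MeetsEveryBase M C → Indep M I →
                                      Empty (I ∩ C) → suc ∣ I ∣ ≡ ∣ B ∣ → Base (M ∖ C) I
  corank-one-avoiding⇒deletion-base b meetsC indI I∩C=∅ size =
    (indI , I∩C=∅) , λ Y (indY , Y∩C=∅) I⊆Y → p⊆q∧∣q∣≤∣p∣⇒q⊆p I⊆Y (≮⇒≥ λ ∣I∣<∣Y∣ →
      Y∩C=∅ (Nonempty-∩-comm (meetsC Y (indep-large⇒base b indY (subst (_≤ ∣ Y ∣) size ∣I∣<∣Y∣)))))

  -- A base B′ of M ∖ D missing C has corank one in M (as A does), and its extension to a
  -- base of M adds an element lying in both C and D.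
  disjoint-meetsEveryBase-deletion : ∀ {C D B A} → MeetsEveryBase M C → MeetsEveryBase M D →
    Empty (C ∩ D) → Base M B → Base (M ∖ D) A → suc ∣ A ∣ ≡ ∣ B ∣ → MeetsEveryBase (M ∖ D) C
  disjoint-meetsEveryBase-deletion {C} {D} {B} meetsC meetsD C∩D=∅ b a size B′ b′@((indB′ , B′∩D=∅) , _) =
    decidable-stable (nonempty? (C ∩ B′)) λ C∩B′=∅ →
      C∩D=∅ (g , x∈p∩q⁺ (g∈ meetsC (C∩B′=∅ ∘ Nonempty-∩-comm) , g∈ meetsD B′∩D=∅))
    where
    size′ : suc ∣ B′ ∣ ≡ ∣ B ∣
    size′ = trans (cong suc (Bases.base-size-unique (∖-isMatroid isMatroid) b′ a)) size
    extension : ∃[ g ] (g ∈ B × g ∉ B′ × Indep M (B′ ∪ ⁅ g ⁆))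
    extension = indep-aug B′ B indB′ (proj₁ b) (≤-reflexive size′)
    g : Fin n
    g = proj₁ extension
    g∈ : ∀ {X} → MeetsEveryBase M X → Empty (B′ ∩ X) → g ∈ X
    g∈ meetsX B′∩X=∅ = corank-one-extension-∈ b meetsX B′∩X=∅ size′
                         (proj₁ (proj₂ (proj₂ extension))) (proj₂ (proj₂ (proj₂ extension)))

module Packing {M : SetSystem n} (isMatroid : IsMatroid M) (Bs : Fin k → Subset n)
  (bases : ∀ t → Base M (Bs t)) (disjoint : PairwiseDisjoint Bs) where
  open IsMatroid isMatroid
  open MatroidProperties isMatroid

  module SmallCocircuit {C : Subset n} (cocircuit : Cocircuit M C) (size : ∣ C ∣ ≡ k) where

    meetsC : MeetsEveryBase M C
    meetsC = proj₁ (proj₂ cocircuit)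

    hits : Hits Bs C
    hits t = Nonempty-∩-comm (meetsC (Bs t) (bases t))

    open TightHittingSet disjoint hits size public

    -- the unique element of C in Bs t
    e : Fin k → Fin n
    e t = proj₁ (hits t)

    e∈Bs : ∀ t → e t ∈ Bs t
    e∈Bs t = proj₁ (x∈p∩q⁻ (Bs t) C (proj₂ (hits t)))

    e∈C : ∀ t → e t ∈ C
    e∈C t = proj₂ (x∈p∩q⁻ (Bs t) C (proj₂ (hits t)))

    A : Fin k → Subset n
    A t = Bs t - e t

    A-size : ∀ t → suc ∣ A t ∣ ≡ ∣ Bs t ∣
    A-size t = x∈p⇒suc∣p-x∣≡∣p∣ (e∈Bs t)

    A-base : ∀ t → Base (M ∖ C) (A t)
    A-base t = corank-one-avoiding⇒deletion-base (bases t) meetsC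
      (indep-down (A t) (Bs t) (proj₁ (bases t)) (p─q⊆p (Bs t) ⁅ e t ⁆))
      (minus-avoids (e∈C t) (e∈Bs t)) (A-size t)

    deletion-disjointBases : HasDisjointBases (M ∖ C) k
    deletion-disjointBases = A , A-base , λ i j i≢j →
      Empty-∩-mono (p─q⊆p (Bs i) ⁅ e i ⁆) (p─q⊆p (Bs j) ⁅ e j ⁆) (disjoint i j i≢j)

  small-cocircuits-disjoint : ∀ {Ci Cj} → Cocircuit M Ci → Cocircuit M Cj →
                              ∣ Ci ∣ ≡ k → ∣ Cj ∣ ≡ k → Ci ≢ Cj → Empty (Ci ∩ Cj)
  small-cocircuits-disjoint {Ci} {Cj} cocI cocJ ∣Ci∣≡k ∣Cj∣≡k Ci≢Cj (x , m) with x∈p∩q⁻ Ci Cj m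
  ... | x∈Ci , x∈Cj with SmallCocircuit.⊆-⋃ cocI ∣Ci∣≡k x∈Ci | cocircuit-⊈ cocI cocJ Ci≢Cj
  ... | t , x∈Bₜ | f , f∈Cj , f∉Ci =
    cocircuit-extends (bases t) cocJ indI I∩Cj=∅ size f∈Cj λ indIf →
      f∉Ci (corank-one-extension-∈ (bases t) (proj₁ (proj₂ cocI)) I∩Ci=∅ size f∉I indIf)
    where
    I : Subset n
    I = Bs t - x
    indI : Indep M I
    indI = indep-down I (Bs t) (proj₁ (bases t)) (p─q⊆p (Bs t) ⁅ x ⁆)
    size : suc ∣ I ∣ ≡ ∣ Bs t ∣
    size = x∈p⇒suc∣p-x∣≡∣p∣ x∈Bₜ
    I∩Ci=∅ : Empty (I ∩ Ci)
    I∩Ci=∅ = SmallCocircuit.minus-avoids cocI ∣Ci∣≡k x∈Ci x∈Bₜ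
    I∩Cj=∅ : Empty (I ∩ Cj)
    I∩Cj=∅ = SmallCocircuit.minus-avoids cocJ ∣Cj∣≡k x∈Cj x∈Bₜ
    f∉I : f ∉ I
    f∉I f∈I = I∩Cj=∅ (f , x∈p∩q⁺ (f∈I , f∈Cj))

  small-cocircuit-minCocircuit-of-deletion : ∀ {Ci Cj} → Fin k → Cocircuit M Ci → Cocircuit M Cj →
    ∣ Ci ∣ ≡ k → ∣ Cj ∣ ≡ k → Ci ≢ Cj → MinCocircuit (M ∖ Cj) Ci
  small-cocircuit-minCocircuit-of-deletion {Ci} {Cj} t cocI cocJ ∣Ci∣≡k ∣Cj∣≡k Ci≢Cj =
    minCocircuit-from-bound Ci⊆E meetsCi λ D meetsD →
      subst (_≤ ∣ D ∣) (sym ∣Ci∣≡k) (disjointBases⇒size≤meetsEveryBase {M = M ∖ Cj} J.deletion-disjointBases meetsD)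
    where
    module J = SmallCocircuit cocJ ∣Cj∣≡k
    Ci∩Cj=∅ : Empty (Ci ∩ Cj)
    Ci∩Cj=∅ = small-cocircuits-disjoint cocI cocJ ∣Ci∣≡k ∣Cj∣≡k Ci≢Cj
    Ci⊆E : Ci ⊆ ground (M ∖ Cj)
    Ci⊆E x∈Ci = x∈p∧x∉q⇒x∈p─q (proj₁ cocI x∈Ci) λ x∈Cj → Ci∩Cj=∅ (_ , x∈p∩q⁺ (x∈Ci , x∈Cj))
    meetsCi : MeetsEveryBase (M ∖ Cj) Ci
    meetsCi = disjoint-meetsEveryBase-deletion (proj₁ (proj₂ cocI)) J.meetsC Ci∩Cj=∅
                (bases t) (J.A-base t) (J.A-size t)

lemma3p3 : (n : ℕ) (M : SetSystem n) → IsMatroid M → Connected M →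
    (k : ℕ) → CogirthIs M k → SigmaIs M k →
    (Ci Cj : Subset n) → MinCocircuit M Ci → MinCocircuit M Cj → Ci ≢ Cj →
    MinCocircuit (M ∖ Cj) Ci
lemma3p3 n M isMatroid _ k cogirth ((Bs , bases , disjoint) , _) Ci Cj minCi minCj Ci≢Cj =
  Packing.small-cocircuit-minCocircuit-of-deletion isMatroid Bs bases disjoint
    (fromℕ< {m = 0} (distinct∧∣p∣≡∣q∣≡k⇒0<k Ci≢Cj ∣Ci∣≡k ∣Cj∣≡k)) (proj₁ minCi) (proj₁ minCj) ∣Ci∣≡k ∣Cj∣≡k Ci≢Cj
  where
  ∣Ci∣≡k : ∣ Ci ∣ ≡ k
  ∣Ci∣≡k = cogirth⇒minCocircuit-size cogirth minCi
  ∣Cj∣≡k : ∣ Cj ∣ ≡ k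
  ∣Cj∣≡k = cogirth⇒minCocircuit-size cogirth minCj
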